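{- In the setting described in the context, for every $A\in\{0,1\}^{s\times k}$ and every $i\in\{k,\ldots,n\}$, \[\sum_{K\in\mathscr D_i}\Lambda_A(K)=0.\]
   Context: Let $G=(V,E)$ be an undirected simple loopless graph with $n$ vertices, a specified edge $v_1v_2\in E$, an edge colouring $c:E\to\{1,\ldots,s\}$, an edge weighting $w:E\to\{0,1\}$, a positive integer $k$ and an integer $t$. Fix a total order $<$ on $V$. Let $\mathbf F=\operatorname{GF}(2^{1+\lceil\log_2 n\rceil})$ (characteristic 2) and let $\mathbf G$ be the polynomial ring over $\mathbf F$ in indeterminates $\mathtt R_{uv}$ ($uv\in E$), $\mathtt X_{uv}$ ($uv\in E\setminus\{v_1v_2\}$), $\mathtt W,\mathtt Y,\mathtt Z$. Let $A\in\{0,1\}^{s\times k}$ have rows $a_1^{\mathsf T},\dots,a_s^{\mathsf T}$ and let $b\in\{0,1\}^k$; $a^{\mathsf T}b$ is computed mod 2. Define the directed multigraph $G'$ on $V$ with labelled arcs: (i) self-loops $(u,u)$ for each $u\in V\setminus\{v_1,v_2\}$, labelled $\lambda_{b,A}((u,u))=\mathtt Z$; (ii) rainbow arcs $(u,v)$ and $(v,u)$ for each $uv\in E$, except that the arc $(v_2,v_1)$ is omitted, labelled $\lambda_{b,A}((u,v))=(a_{c(uv)}^{\mathsf T}b)\mathtt R_{uv}\mathtt W^{w(uv)}$ if $u<v$ and $(1+a_{c(uv)}^{\mathsf T}b)\mathtt R_{uv}\mathtt W^{w(uv)}$ if $u>v$; the weight of rainbow arc $(u,v)$ is $w(uv)$;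 (iii) extra arcs $\langle u,v\rangle$ and $\langle v,u\rangle$ for each $uv\in E\setminus\{v_1v_2\}$, both labelled $\mathtt X_{uv}\mathtt Y$. For a subgraph (arc set) $H$ of $G'$, $\lambda_{b,A}(H)=\prod_{e\in E(H)}\lambda_{b,A}(e)$ and $\Lambda_A(H)=\sum_{b\in\{0,1\}^k}\lambda_{b,A}(H)$. A cycle cover of $G'$ is a set of arcs in which every vertex has exactly one outgoing and one incoming arc (a self-loop counts as both); it is a vertex-disjoint union of directed cycles. $\mathscr C_i$ denotes the set of cycle covers of $G'$ containing exactly $k$ rainbow arcs of total weight $t$ and exactly $n-i$ self-loops (hence $i-k$ extra arcs). A directed cycle of a cover is defective if it contains a rainbow arc but does not contain the arc $(v_1,v_2)$. $\mathscr D_i\subseteq\mathscr C_i$ is the set of covers in $\mathscr C_i$ that contain a defective cycle. -}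

module Defs where

open import Level using (0ℓ)
open import Data.Nat using (ℕ; zero; suc; _≤_; _∸_; _+_)
open import Data.Integer using (ℤ; +_)
open import Data.Bool using (Bool; true; false; if_then_else_; _xor_; _∧_; not)
open import Data.Fin using (Fin; zero; suc; _<?_)
open import Data.Vec using (Vec; lookup)
import Data.Vec.Functional as VF
open import Data.List using (List; []; _∷_; map)
open import Data.Product using (Σ; Σ-syntax; _×_; _,_)
open import Data.Sum using (_⊎_)
open import Relation.Nullary using (¬_; does)
open import Relation.Binary.PropositionalEquality using (_≡_; _≢_)
open import Algebra.Bundles using (CommutativeRing)

-- The combinatorial input: a simple loopless undirected graph on the
-- vertex set Fin n (totally ordered by the order of Fin), a specified
-- edge v₁v₂, an edge colouring into Fin s (= {1,…,s}), an edge weighting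
-- into {0,1} (= Bool), a positive integer k and an integer t.
-- Edge-indexed data are given as functions on ordered pairs which are
-- required to be symmetric on edges (values off edges are irrelevant).

record Instance : Set₁ where
  field
    n s k      : ℕ
    Adj        : Fin n → Fin n → Set
    Adj-sym    : ∀ {u v} → Adj u v → Adj v u
    Adj-irrefl : ∀ {u} → ¬ Adj u u
    v₁ v₂      : Fin n
    v₁v₂∈E     : Adj v₁ v₂
    colour     : Fin n → Fin n → Fin s
    colour-sym : ∀ {u v} → Adj u v → colour u v ≡ colour v u
    weight     : Fin n → Fin n → Bool
    weight-sym : ∀ {u v} → Adj u v → weight u v ≡ weight v u
    k-pos      : 1 ≤ k
    t          : ℤ

-- Values of the indeterminates R_uv (uv ∈ E), X_uv (uv ∈ E∖{v₁v₂}),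
-- W, Y, Z in a commutative ring.

record Assignment (I : Instance) (Rg : CommutativeRing 0ℓ 0ℓ) : Set where
  open Instance I
  open CommutativeRing Rg using (Carrier; _≈_)
  field
    𝚁     : Fin n → Fin n → Carrier
    𝚁-sym : ∀ {u v} → Adj u v → 𝚁 u v ≈ 𝚁 v u
    𝚇     : Fin n → Fin n → Carrier
    𝚇-sym : ∀ {u v} → Adj u v → 𝚇 u v ≈ 𝚇 v u
    𝚆 𝚈 𝚉 : Carrier

-- Arc kinds of G': self-loops, rainbow arcs (u,v), extra arcs ⟨u,v⟩.

data Kind : Set where
  loop rainbow extra : Kind

-- A set of arcs of G' in which every vertex has exactly one outgoing arc
-- is encoded by, for every vertex u, the head (next u) of its outgoing arc
-- and the kind of that arc (between given tail/head there is at most one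
-- arc of each kind in G').
record Cover (n : ℕ) : Set where
  constructor mkCover
  field
    nextV : Vec (Fin n) n
    kindV : Vec Kind n
  next : Fin n → Fin n
  next = lookup nextV
  kind : Fin n → Kind
  kind = lookup kindV

iterate : ∀ {n} → (Fin n → Fin n) → ℕ → Fin n → Fin n
iterate f zero    u = u
iterate f (suc m) u = f (iterate f m u)

count : ∀ {n} → (Fin n → Bool) → ℕ
count {zero}  p = 0
count {suc n} p = (if p zero then 1 else 0) + count (λ u → p (suc u))

sumℕ : ∀ {n} → (Fin n → ℕ) → ℕ
sumℕ {zero}  f = 0
sumℕ {suc n} f = f zero + sumℕ (λ u → f (suc u))

isRainbow : Kind → Bool
isRainbow rainbow = true
isRainbow _       = false

isLoop : Kind → Bool
isLoop loop = true
isLoop _    = false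

bitℕ : Bool → ℕ
bitℕ true  = 1
bitℕ false = 0

dot : ∀ {k} → (Fin k → Bool) → (Fin k → Bool) → Bool
dot {zero}  a b = false
dot {suc k} a b = (a zero ∧ b zero) xor dot (λ j → a (suc j)) (λ j → b (suc j))

module _ (I : Instance) where
  open Instance I

  IsArc : Fin n → Fin n → Kind → Set
  IsArc u v loop    = v ≡ u × u ≢ v₁ × u ≢ v₂
  IsArc u v rainbow = Adj u v × ¬ (u ≡ v₂ × v ≡ v₁)
  IsArc u v extra   = Adj u v × ¬ ((u ≡ v₁ × v ≡ v₂) ⊎ (u ≡ v₂ × v ≡ v₁))

  -- K is a cycle cover of G': every vertex has exactly one outgoing arc
  -- (by the encoding) and exactly one incoming arc (next is injective).
  IsCycleCover : Cover n → Set
  IsCycleCover K =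
    (∀ u → IsArc u (next u) (kind u)) ×
    (∀ u u′ → next u ≡ next u′ → u ≡ u′)
    where open Cover K

  InC : ℕ → Cover n → Set
  InC i K =
    IsCycleCover K ×
    count (λ u → isRainbow (kind u)) ≡ k ×
    + sumℕ (λ u → if isRainbow (kind u) then bitℕ (weight u (next u)) else 0) ≡ t ×
    count (λ u → isLoop (kind u)) ≡ n ∸ i
    where open Cover K

  CycleThroughContains-v₁v₂ : Cover n → Fin n → Set
  CycleThroughContains-v₁v₂ K u =
    Σ[ m ∈ ℕ ] (iterate next m u ≡ v₁ × next v₁ ≡ v₂ × kind v₁ ≡ rainbow)
    where open Cover K

  HasDefectiveCycle : Cover n → Set
  HasDefectiveCycle K =
    Σ[ u ∈ Fin n ] (kind u ≡ rainbow × ¬ CycleThroughContains-v₁v₂ K u)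
    where open Cover K

  InD : ℕ → Cover n → Set
  InD i K = InC i K × HasDefectiveCycle K

  module _ (Rg : CommutativeRing 0ℓ 0ℓ) (ν : Assignment I Rg) where
    open CommutativeRing Rg using (Carrier; 0#; 1#) renaming (_+_ to _⊕_; _*_ to _⊛_)
    open Assignment ν

    fromBool : Bool → Carrier
    fromBool true  = 1#
    fromBool false = 0#

    W^ : Bool → Carrier
    W^ true  = 𝚆
    W^ false = 1#

    prodV : ∀ {m} → (Fin m → Carrier) → Carrier
    prodV {zero}  f = 1#
    prodV {suc m} f = f zero ⊛ prodV (λ u → f (suc u))

    sumBits : ∀ {m} → ((Fin m → Bool) → Carrier) → Carrier
    sumBits {zero}  f = f (λ ())
    sumBits {suc m} f = sumBits (λ b → f (false VF.∷ b)) ⊕ sumBits (λ b → f (true VF.∷ b))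

    sumList : List Carrier → Carrier
    sumList []       = 0#
    sumList (x ∷ xs) = x ⊕ sumList xs

    module _ (A : Fin s → Fin k → Bool) where

      arcLabel : (Fin k → Bool) → Fin n → Fin n → Kind → Carrier
      arcLabel b u v loop    = 𝚉
      arcLabel b u v rainbow =
        fromBool (if does (u <? v) then dot (A (colour u v)) b
                                   else not (dot (A (colour u v)) b))
        ⊛ 𝚁 u v ⊛ W^ (weight u v)
      arcLabel b u v extra   = 𝚇 u v ⊛ 𝚈

      λ[_] : (Fin k → Bool) → Cover n → Carrier
      λ[ b ] K = prodV (λ u → arcLabel b u (next u) (kind u))
        where open Cover K

      Λ : Cover n → Carrier
      Λ K = sumBits (λ b → λ[ b ] K)

module Submission where

-- Reversing every defective cycle of a cover is an involution σ on 𝒟ᵢ. It permutes the arc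
-- coefficients and changes the bit a_c·b of a reversed rainbow arc only by the constant 1. A cover
-- in 𝒟ᵢ has exactly k rainbow arcs, and over GF(2)^k the sum of a product of k affine forms does not
-- depend on their constants (a product of fewer than k of them sums to zero in characteristic 2), so
-- Λ(σK) = Λ(K). A fixed point of σ contains a rainbow 2-cycle, whose two labels carry complementary
-- bits, so Λ vanishes there; all other covers cancel in pairs {K, σK}.

open import Defs
open import Level using (0ℓ)
open import Data.Nat using (ℕ; _≤_)
open import Data.Fin using (Fin)
open import Data.Bool using (Bool)
open import Data.List using (List; map)
open import Data.List.Relation.Unary.Unique.Propositional using (Unique)
open import Data.List.Membership.Propositional using (_∈_)
open import Function.Bundles using (_⇔_; Equivalence)
open import Algebra.Bundles using (CommutativeRing)
open import Data.List.Relation.Unary.All as All using ()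
open import Data.Product using (_,_)

module BooleanCube where

  open import Data.Nat using (ℕ; zero; suc; _≤_; _<_; s≤s)
  open import Data.Fin using (Fin; zero; suc)
  open import Data.Bool using (Bool; true; false; _xor_; _∧_)
  open import Data.Bool.Properties using (xor-assoc; xor-comm)
  open import Data.Maybe using (Maybe; just; nothing; is-just)
  open import Data.Maybe.Relation.Binary.Pointwise as Maybeᴾ using (just; nothing)
  open import Data.List using (List; []; _∷_; _++_; length; map; catMaybes)
  open import Data.List.Properties using (length-map)
  open import Data.List.Relation.Binary.Pointwise as Listᴾ using (Pointwise; []; _∷_)
  open import Data.Product using (_×_; _,_; proj₁)
  open import Data.Vec.Functional using (toList) renaming (_∷_ to _◃_)
  open import Function using (_∘_; _on_)
  open import Relation.Binary.PropositionalEquality as ≡ using (_≡_)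
  import Algebra.Properties.CommutativeSemigroup as CommutativeSemigroupProperties
  import Algebra.Properties.CommutativeMonoid.Sum as CommutativeMonoidSum

  length-++-∷ : ∀ {A : Set} (xs : List A) y ys → length (xs ++ y ∷ ys) ≡ suc (length (xs ++ ys))
  length-++-∷ []       y ys = ≡.refl
  length-++-∷ (x ∷ xs) y ys = ≡.cong suc (length-++-∷ xs y ys)

  catMaybes⁺ : ∀ {A : Set} {_∼_ : A → A → Set} {xs ys} →
               Pointwise (Maybeᴾ.Pointwise _∼_) xs ys → Pointwise _∼_ (catMaybes xs) (catMaybes ys)
  catMaybes⁺ []                  = []
  catMaybes⁺ (just x∼y ∷ xs∼ys)  = x∼y ∷ catMaybes⁺ xs∼ys
  catMaybes⁺ (nothing ∷ xs∼ys)   = catMaybes⁺ xs∼ys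

  length-catMaybes-toList : ∀ {A : Set} {N} (f : Fin N → Maybe A) → length (catMaybes (toList f)) ≡ count (is-just ∘ f)
  length-catMaybes-toList {N = zero}  f = ≡.refl
  length-catMaybes-toList {N = suc N} f with f zero
  ... | just _  = ≡.cong suc (length-catMaybes-toList (f ∘ suc))
  ... | nothing = length-catMaybes-toList (f ∘ suc)

  module CubeSum {c ℓ} (R : CommutativeRing c ℓ) where
    open CommutativeRing R hiding (zero)
    open import Relation.Binary.Reasoning.Setoid setoid
    open CommutativeSemigroupProperties *-commutativeSemigroup using (x∙yz≈y∙xz)
    open CommutativeMonoidSum *-commutativeMonoid using () renaming (sum to ∏)

    Cube : ℕ → Set
    Cube m = Fin m → Bool

    𝟙 : Bool → Carrier
    𝟙 true  = 1#
    𝟙 false = 0#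

    ∑𝔹 : ∀ {m} → (Cube m → Carrier) → Carrier
    ∑𝔹 {zero}  F = F (λ ())
    ∑𝔹 {suc m} F = ∑𝔹 (λ b → F (false ◃ b)) + ∑𝔹 (λ b → F (true ◃ b))

    ∑𝔹-cong : ∀ {m} {F G : Cube m → Carrier} → (∀ b → F b ≈ G b) → ∑𝔹 F ≈ ∑𝔹 G
    ∑𝔹-cong {zero}  F≈G = F≈G _
    ∑𝔹-cong {suc m} F≈G = +-cong (∑𝔹-cong (F≈G ∘ (false ◃_))) (∑𝔹-cong (F≈G ∘ (true ◃_)))

    ∑𝔹-distrib-+ : ∀ {m} (F G : Cube m → Carrier) → ∑𝔹 (λ b → F b + G b) ≈ ∑𝔹 F + ∑𝔹 G
    ∑𝔹-distrib-+ {zero}  F G = refl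
    ∑𝔹-distrib-+ {suc m} F G = begin
      ∑𝔹 (λ b → F (false ◃ b) + G (false ◃ b)) + ∑𝔹 (λ b → F (true ◃ b) + G (true ◃ b))
        ≈⟨ +-cong (∑𝔹-distrib-+ (F ∘ (false ◃_)) (G ∘ (false ◃_))) (∑𝔹-distrib-+ (F ∘ (true ◃_)) (G ∘ (true ◃_))) ⟩
      (∑𝔹 (F ∘ (false ◃_)) + ∑𝔹 (G ∘ (false ◃_))) + (∑𝔹 (F ∘ (true ◃_)) + ∑𝔹 (G ∘ (true ◃_)))
        ≈⟨ CommutativeSemigroupProperties.interchange +-commutativeSemigroup _ _ _ _ ⟩
      ∑𝔹 F + ∑𝔹 G ∎

    ∑𝔹-*ˡ : ∀ {m} x (F : Cube m → Carrier) → ∑𝔹 (λ b → x * F b) ≈ x * ∑𝔹 F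
    ∑𝔹-*ˡ {zero}  x F = refl
    ∑𝔹-*ˡ {suc m} x F = trans (+-cong (∑𝔹-*ˡ x (F ∘ (false ◃_))) (∑𝔹-*ˡ x (F ∘ (true ◃_)))) (sym (distribˡ x _ _))

    ∑𝔹-zero : ∀ {m} {F : Cube m → Carrier} → (∀ b → F b ≈ 0#) → ∑𝔹 F ≈ 0#
    ∑𝔹-zero {zero}  F≈0 = F≈0 _
    ∑𝔹-zero {suc m} F≈0 = trans (+-cong (∑𝔹-zero (F≈0 ∘ (false ◃_))) (∑𝔹-zero (F≈0 ∘ (true ◃_)))) (+-identityʳ 0#)

    -- An affine form b ↦ a·b + c on the cube, given by its linear part a and constant c.
    Affine : ℕ → Set
    Affine m = Cube m × Bool

    ⟦_⟧ : ∀ {m} → Affine m → Cube m → Carrier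
    ⟦ a , c ⟧ b = 𝟙 (dot a b xor c)

    SameLinear : ∀ {m} → Affine m → Affine m → Set
    SameLinear = _≡_ on proj₁

    ∏⟦_⟧ : ∀ {m} → List (Affine m) → Cube m → Carrier
    ∏⟦ [] ⟧     b = 1#
    ∏⟦ α ∷ αs ⟧ b = ⟦ α ⟧ b * ∏⟦ αs ⟧ b

    ∏⟦⟧-++-∷ : ∀ {m} (ps : List (Affine m)) α αs b → ∏⟦ ps ++ α ∷ αs ⟧ b ≈ ⟦ α ⟧ b * ∏⟦ ps ++ αs ⟧ b
    ∏⟦⟧-++-∷ []       α αs b = refl
    ∏⟦⟧-++-∷ (p ∷ ps) α αs b = trans (*-congˡ (∏⟦⟧-++-∷ ps α αs b)) (x∙yz≈y∙xz _ _ _)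

    -- Substituting x for the first coordinate.
    restrict : ∀ {m} → Bool → Affine (suc m) → Affine m
    restrict x (a , c) = (a ∘ suc) , ((a zero ∧ x) xor c)

    ∏⟦⟧-restrict : ∀ {m} x (αs : List (Affine (suc m))) b → ∏⟦ map (restrict x) αs ⟧ b ≡ ∏⟦ αs ⟧ (x ◃ b)
    ∏⟦⟧-restrict x []            b = ≡.refl
    ∏⟦⟧-restrict x ((a , c) ∷ αs) b =
      ≡.cong₂ _*_ (≡.cong 𝟙 (≡.trans (≡.sym (xor-assoc d (a zero ∧ x) c)) (≡.cong (_xor c) (xor-comm d (a zero ∧ x)))))
                  (∏⟦⟧-restrict x αs b)
      where d = dot (a ∘ suc) b

    ⟦_⟧? : ∀ {m} → Maybe (Affine m) → Cube m → Carrier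
    ⟦ nothing ⟧? b = 1#
    ⟦ just α  ⟧? b = ⟦ α ⟧ b

    ∏⟦⟧?≈∏⟦catMaybes⟧ : ∀ {N m} (f : Fin N → Maybe (Affine m)) b → ∏ (λ u → ⟦ f u ⟧? b) ≈ ∏⟦ catMaybes (toList f) ⟧ b
    ∏⟦⟧?≈∏⟦catMaybes⟧ {zero}  f b = refl
    ∏⟦⟧?≈∏⟦catMaybes⟧ {suc N} f b with f zero
    ... | just α  = *-congˡ (∏⟦⟧?≈∏⟦catMaybes⟧ (f ∘ suc) b)
    ... | nothing = trans (*-identityˡ _) (∏⟦⟧?≈∏⟦catMaybes⟧ (f ∘ suc) b)

  module CharacteristicTwo {c ℓ} (R : CommutativeRing c ℓ)
    (1+1≈0 : CommutativeRing._≈_ R (CommutativeRing._+_ R (CommutativeRing.1# R) (CommutativeRing.1# R)) (CommutativeRing.0# R)) where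
    open CommutativeRing R hiding (zero)
    open import Relation.Binary.Reasoning.Setoid setoid
    open CubeSum R
    open CommutativeMonoidSum *-commutativeMonoid using () renaming (sum to ∏)

    x+x≈0 : ∀ x → x + x ≈ 0#
    x+x≈0 x = begin
      x + x             ≈⟨ +-cong (*-identityˡ x) (*-identityˡ x) ⟨
      1# * x + 1# * x   ≈⟨ distribʳ x 1# 1# ⟨
      (1# + 1#) * x     ≈⟨ *-congʳ 1+1≈0 ⟩
      0# * x            ≈⟨ zeroˡ x ⟩
      0#                ∎

    𝟙-xor : ∀ p q → 𝟙 (p xor q) ≈ 𝟙 p + 𝟙 q
    𝟙-xor false q     = sym (+-identityˡ (𝟙 q))
    𝟙-xor true  false = sym (+-identityʳ 1#)
    𝟙-xor true  true  = sym 1+1≈0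

    ∑⟦⟧*-constant-irrelevant : ∀ {m} a c {G : Cube m → Carrier} → ∑𝔹 G ≈ 0# →
                                ∑𝔹 (λ b → ⟦ a , c ⟧ b * G b) ≈ ∑𝔹 (λ b → 𝟙 (dot a b) * G b)
    ∑⟦⟧*-constant-irrelevant a c {G} ∑G≈0 = begin
      ∑𝔹 (λ b → 𝟙 (dot a b xor c) * G b)                   ≈⟨ ∑𝔹-cong (λ b → trans (*-congʳ (𝟙-xor (dot a b) c)) (distribʳ (G b) _ _)) ⟩
      ∑𝔹 (λ b → 𝟙 (dot a b) * G b + 𝟙 c * G b)             ≈⟨ ∑𝔹-distrib-+ (λ b → 𝟙 (dot a b) * G b) (λ b → 𝟙 c * G b) ⟩
      ∑𝔹 (λ b → 𝟙 (dot a b) * G b) + ∑𝔹 (λ b → 𝟙 c * G b) ≈⟨ +-congˡ (trans (∑𝔹-*ˡ (𝟙 c) G) (trans (*-congˡ ∑G≈0) (zeroʳ (𝟙 c)))) ⟩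
      ∑𝔹 (λ b → 𝟙 (dot a b) * G b) + 0#                    ≈⟨ +-identityʳ _ ⟩
      ∑𝔹 (λ b → 𝟙 (dot a b) * G b)                         ∎

    ∑⟦⟧*-SameLinear : ∀ {m} {α β : Affine m} {G : Cube m → Carrier} → SameLinear α β → ∑𝔹 G ≈ 0# →
                       ∑𝔹 (λ b → ⟦ α ⟧ b * G b) ≈ ∑𝔹 (λ b → ⟦ β ⟧ b * G b)
    ∑⟦⟧*-SameLinear {α = a , c} {β = .a , c′} ≡.refl ∑G≈0 =
      trans (∑⟦⟧*-constant-irrelevant a c ∑G≈0) (sym (∑⟦⟧*-constant-irrelevant a c′ ∑G≈0))

    -- Vanishing: the two restrictions to the first coordinate differ only in their constants, so by
    -- invariance their sums agree and cancel. Invariance: changing the constant of one form adds the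
    -- sum of the product of the others, which vanishes.
    mutual
      ∑∏⟦⟧-vanishes : ∀ {m} (αs : List (Affine m)) → length αs < m → ∑𝔹 ∏⟦ αs ⟧ ≈ 0#
      ∑∏⟦⟧-vanishes {suc m} αs (s≤s |αs|≤m) = begin
        ∑𝔹 (λ b → ∏⟦ αs ⟧ (false ◃ b)) + ∑𝔹 (λ b → ∏⟦ αs ⟧ (true ◃ b))
          ≈⟨ +-cong (∑𝔹-cong (reflexive ∘ ≡.sym ∘ ∏⟦⟧-restrict false αs)) (∑𝔹-cong (reflexive ∘ ≡.sym ∘ ∏⟦⟧-restrict true αs)) ⟩
        ∑𝔹 ∏⟦ map (restrict false) αs ⟧ + ∑𝔹 ∏⟦ map (restrict true) αs ⟧
          ≈⟨ +-congˡ (∑∏⟦⟧-invariant [] same-linear |αs₁|≤m) ⟩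
        ∑𝔹 ∏⟦ map (restrict false) αs ⟧ + ∑𝔹 ∏⟦ map (restrict false) αs ⟧
          ≈⟨ x+x≈0 _ ⟩
        0# ∎
        where
        same-linear : Pointwise SameLinear (map (restrict true) αs) (map (restrict false) αs)
        same-linear = Listᴾ.map⁺ (restrict true) (restrict false) (Listᴾ.refl ≡.refl {αs})
        |αs₁|≤m : length (map (restrict true) αs) ≤ m
        |αs₁|≤m = ≡.subst (_≤ m) (≡.sym (length-map (restrict true) αs)) |αs|≤m

      ∑∏⟦⟧-invariant : ∀ {m} (ps : List (Affine m)) {αs βs} → Pointwise SameLinear αs βs →
                       length (ps ++ αs) ≤ m → ∑𝔹 ∏⟦ ps ++ αs ⟧ ≈ ∑𝔹 ∏⟦ ps ++ βs ⟧
      ∑∏⟦⟧-invariant ps [] _ = refl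
      ∑∏⟦⟧-invariant {m} ps {α ∷ αs} {β ∷ βs} (α∼β ∷ αs∼βs) |ps++α∷αs|≤m = begin
        ∑𝔹 ∏⟦ ps ++ α ∷ αs ⟧                       ≈⟨ ∑𝔹-cong (∏⟦⟧-++-∷ ps α αs) ⟩
        ∑𝔹 (λ b → ⟦ α ⟧ b * ∏⟦ ps ++ αs ⟧ b)       ≈⟨ ∑⟦⟧*-SameLinear α∼β (∑∏⟦⟧-vanishes (ps ++ αs) |ps++αs|<m) ⟩
        ∑𝔹 ∏⟦ β ∷ ps ++ αs ⟧                       ≈⟨ ∑∏⟦⟧-invariant (β ∷ ps) αs∼βs |ps++αs|<m ⟩
        ∑𝔹 ∏⟦ β ∷ ps ++ βs ⟧                       ≈⟨ ∑𝔹-cong (∏⟦⟧-++-∷ ps β βs) ⟨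
        ∑𝔹 ∏⟦ ps ++ β ∷ βs ⟧                       ∎
        where
        |ps++αs|<m : length (ps ++ αs) < m
        |ps++αs|<m = ≡.subst (_≤ m) (length-++-∷ ps α αs) |ps++α∷αs|≤m

    ∑∏⟦⟧?-invariant : ∀ {N m} (f g : Fin N → Maybe (Affine m)) → (∀ u → Maybeᴾ.Pointwise SameLinear (f u) (g u)) →
                      count (is-just ∘ f) ≤ m → ∑𝔹 (λ b → ∏ (λ u → ⟦ f u ⟧? b)) ≈ ∑𝔹 (λ b → ∏ (λ u → ⟦ g u ⟧? b))
    ∑∏⟦⟧?-invariant f g f∼g #f≤m = begin
      ∑𝔹 (λ b → ∏ (λ u → ⟦ f u ⟧? b))   ≈⟨ ∑𝔹-cong (∏⟦⟧?≈∏⟦catMaybes⟧ f) ⟩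
      ∑𝔹 ∏⟦ catMaybes (toList f) ⟧       ≈⟨ ∑∏⟦⟧-invariant [] (catMaybes⁺ (Listᴾ.tabulate⁺ f∼g))
                                                            (≡.subst (_≤ _) (≡.sym (length-catMaybes-toList f)) #f≤m) ⟩
      ∑𝔹 ∏⟦ catMaybes (toList g) ⟧       ≈⟨ ∑𝔹-cong (∏⟦⟧?≈∏⟦catMaybes⟧ g) ⟨
      ∑𝔹 (λ b → ∏ (λ u → ⟦ g u ⟧? b))   ∎

module InvolutionSums where

  open import Data.Nat using (suc; _≤_; s≤s)
  open import Data.Nat.Properties using (≤-trans; n≤1+n; ≤-reflexive)
  open import Data.List using (List; []; _∷_; map; foldr; length)
  open import Data.List.Properties using (length-removeAt′)
  open import Data.List.Relation.Unary.Any using (here; there; _─_; index)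
  open import Data.List.Relation.Unary.All as All using (All; []; _∷_)
  import Data.List.Relation.Unary.All.Properties as All
  open import Data.List.Relation.Unary.AllPairs using ([]; _∷_)
  open import Data.List.Relation.Unary.Unique.Propositional using (Unique)
  open import Data.List.Membership.Propositional using (_∈_; _∉_)
  open import Data.Sum using (_⊎_; inj₁; inj₂)
  open import Relation.Nullary using (yes; no; contradiction)
  open import Relation.Binary.Definitions using (DecidableEquality)
  open import Relation.Binary.PropositionalEquality as ≡ using (_≡_)

  module _ {A : Set} where

    ∈-─⁻ : ∀ {x y} {xs : List A} (p : x ∈ xs) → y ∈ (xs ─ p) → y ∈ xs
    ∈-─⁻ (here _)  q         = there q
    ∈-─⁻ (there p) (here q)  = here q
    ∈-─⁻ (there p) (there q) = there (∈-─⁻ p q)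

    ∈-─⁺ : ∀ {x y} {xs : List A} (p : x ∈ xs) → y ∈ xs → y ≡ x ⊎ y ∈ (xs ─ p)
    ∈-─⁺ (here ≡.refl) (here q)  = inj₁ q
    ∈-─⁺ (here ≡.refl) (there q) = inj₂ q
    ∈-─⁺ (there p)     (here q)  = inj₂ (here q)
    ∈-─⁺ (there p)     (there q) with ∈-─⁺ p q
    ... | inj₁ y≡x = inj₁ y≡x
    ... | inj₂ q′  = inj₂ (there q′)

    Unique-─ : ∀ {x} {xs : List A} (p : x ∈ xs) → Unique xs → Unique (xs ─ p)
    Unique-─ (here _)  (_ ∷ u)    = u
    Unique-─ (there p) (x∉ ∷ u) = All.─⁺ p x∉ ∷ Unique-─ p u

    ∉-─ : ∀ {x} {xs : List A} (p : x ∈ xs) → Unique xs → x ∉ (xs ─ p)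
    ∉-─ (here ≡.refl) (x∉ ∷ _) q         = All.lookup x∉ q ≡.refl
    ∉-─ (there p)     (y∉ ∷ _) (here ≡.refl) = All.lookup y∉ p ≡.refl
    ∉-─ (there p)     (_ ∷ u)  (there q) = ∉-─ p u q

  module InvolutionSum {c ℓ} (R : CommutativeRing c ℓ)
    (1+1≈0 : CommutativeRing._≈_ R (CommutativeRing._+_ R (CommutativeRing.1# R) (CommutativeRing.1# R)) (CommutativeRing.0# R))
    {C : Set} (_≟_ : DecidableEquality C) (σ : C → C) (Q : C → Set) (Λ : C → CommutativeRing.Carrier R)
    (σ-involutive : ∀ {K} → Q K → σ (σ K) ≡ K)
    (Λ∘σ : ∀ {K} → Q K → CommutativeRing._≈_ R (Λ (σ K)) (Λ K))
    (Λ-fixed : ∀ {K} → Q K → σ K ≡ K → CommutativeRing._≈_ R (Λ K) (CommutativeRing.0# R)) where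
    open CommutativeRing R
    open import Relation.Binary.Reasoning.Setoid setoid
    open BooleanCube.CharacteristicTwo R 1+1≈0 using (x+x≈0)
    open import Algebra.Properties.CommutativeSemigroup +-commutativeSemigroup using (x∙yz≈y∙xz)

    sum : List Carrier → Carrier
    sum = foldr _+_ 0#

    sum-─ : ∀ {K} {L : List C} (p : K ∈ L) → sum (map Λ L) ≈ Λ K + sum (map Λ (L ─ p))
    sum-─ (here ≡.refl) = refl
    sum-─ {L = K′ ∷ L} (there p) = trans (+-congˡ (sum-─ p)) (x∙yz≈y∙xz (Λ K′) _ _)

    Closed : List C → Set
    Closed L = ∀ {K} → K ∈ L → σ K ∈ L

    σ-injective : ∀ {K K′} → Q K → Q K′ → σ K ≡ σ K′ → K ≡ K′
    σ-injective {K} {K′} qK qK′ eq = ≡.trans (≡.sym (σ-involutive qK)) (≡.trans (≡.cong σ eq) (σ-involutive qK′))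

    Closed-drop-fixed : ∀ {K T} → Unique (K ∷ T) → All Q (K ∷ T) → σ K ≡ K → Closed (K ∷ T) → Closed T
    Closed-drop-fixed (K∉T ∷ _) (qK ∷ qT) σK≡K closed K′∈T with closed (there K′∈T)
    ... | there σK′∈T = σK′∈T
    ... | here σK′≡K  = contradiction (σ-injective (All.lookup qT K′∈T) qK (≡.trans σK′≡K (≡.sym σK≡K)))
                                      (λ K′≡K → All.lookup K∉T K′∈T (≡.sym K′≡K))

    Closed-drop-pair : ∀ {K T} (σK∈T : σ K ∈ T) → Unique (K ∷ T) → All Q (K ∷ T) → Closed (K ∷ T) → Closed (T ─ σK∈T)
    Closed-drop-pair σK∈T (K∉T ∷ uT) (qK ∷ qT) closed {K′} K′∈T′ with closed (there (∈-─⁻ σK∈T K′∈T′))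
    ... | here σK′≡K = contradiction (≡.subst (_∈ _) (≡.trans (≡.sym (σ-involutive qK′)) (≡.cong σ σK′≡K)) K′∈T′) (∉-─ σK∈T uT)
      where qK′ = All.lookup qT (∈-─⁻ σK∈T K′∈T′)
    ... | there σK′∈T with ∈-─⁺ σK∈T σK′∈T
    ...   | inj₂ σK′∈T′ = σK′∈T′
    ...   | inj₁ σK′≡σK = contradiction (σ-injective (All.lookup qT (∈-─⁻ σK∈T K′∈T′)) qK σK′≡σK)
                                        (λ K′≡K → All.lookup K∉T (∈-─⁻ σK∈T K′∈T′) (≡.sym K′≡K))

    -- Induction on a bound for the length, since dropping a pair is not structural.
    ∑-vanishes-bounded : ∀ n (L : List C) → length L ≤ n → Unique L → All Q L → Closed L → sum (map Λ L) ≈ 0#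
    ∑-vanishes-bounded n       []      _              _          _          _      = refl
    ∑-vanishes-bounded (suc n) (K ∷ T) (s≤s |T|≤n) u@(_ ∷ uT) q@(qK ∷ qT) closed with σ K ≟ K
    ... | yes σK≡K = begin
      Λ K + sum (map Λ T) ≈⟨ +-cong (Λ-fixed qK σK≡K) (∑-vanishes-bounded n T |T|≤n uT qT (Closed-drop-fixed u q σK≡K closed)) ⟩
      0# + 0#             ≈⟨ +-identityʳ 0# ⟩
      0#                  ∎
    ... | no σK≢K with closed (here ≡.refl)
    ...   | here σK≡K   = contradiction σK≡K σK≢K
    ...   | there σK∈T = begin
      Λ K + sum (map Λ T)                   ≈⟨ +-congˡ (sum-─ σK∈T) ⟩
      Λ K + (Λ (σ K) + sum (map Λ T′))      ≈⟨ +-assoc _ _ _ ⟨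
      (Λ K + Λ (σ K)) + sum (map Λ T′)      ≈⟨ +-cong (trans (+-congˡ (Λ∘σ qK)) (x+x≈0 (Λ K))) rest≈0 ⟩
      0# + 0#                               ≈⟨ +-identityʳ 0# ⟩
      0#                                    ∎
      where
      T′ = T ─ σK∈T
      rest≈0 : sum (map Λ T′) ≈ 0#
      rest≈0 = ∑-vanishes-bounded n T′ (≤-trans (n≤1+n _) (≤-trans (≤-reflexive (≡.sym (length-removeAt′ T (index σK∈T)))) |T|≤n))
                 (Unique-─ σK∈T uT) (All.─⁺ σK∈T qT) (Closed-drop-pair σK∈T u q closed)

    ∑-vanishes : ∀ (L : List C) → Unique L → All Q L → Closed L → sum (map Λ L) ≈ 0#
    ∑-vanishes L = ∑-vanishes-bounded (length L) L (≤-reflexive ≡.refl)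

module FunctionalGraphs where

  open import Data.Nat using (zero; suc; _+_; _*_; _∸_; _≤_; _<_; _<?_)
  open import Data.Nat.Properties using (n<1+n; ≮⇒≥; ≤-trans; m∸n+n≡m; +-monoʳ-<; +-comm; *-suc; m≤n⇒∃[o]m+o≡n; +-suc)
  open import Data.Nat.Induction using (<-rec)
  open import Data.Fin using (Fin; zero; suc; toℕ; fromℕ<; _≟_)
  open import Data.Fin.Properties using (pigeonhole; any?; toℕ≤pred[n]; toℕ-fromℕ<)
  open import Data.Product using (∃; _,_)
  open import Function using (_∘_)
  open import Relation.Nullary using (Dec; yes; no; does; ¬_; contradiction)
  open import Relation.Nullary.Decidable using (map′; dec-true; dec-false)
  open import Data.Bool using (if_then_else_)
  open import Data.Sum using (_⊎_; inj₁; inj₂)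
  open import Data.Product using (_×_)
  open import Relation.Binary.Definitions using (Decidable)
  open import Relation.Binary.PropositionalEquality as ≡ using (_≡_; refl; sym; trans; cong)
  open ≡.≡-Reasoning

  if-yes : ∀ {P A : Set} (P? : Dec P) {x y : A} → P → (if does P? then x else y) ≡ x
  if-yes P? p = cong (if_then _ else _) (dec-true P? p)

  if-no : ∀ {P A : Set} (P? : Dec P) {x y : A} → ¬ P → (if does P? then x else y) ≡ y
  if-no P? ¬p = cong (if_then _ else _) (dec-false P? ¬p)

  module Orbits {n} (f : Fin n → Fin n) where

    infix 4 _⟶*_
    _⟶*_ : Fin n → Fin n → Set
    u ⟶* v = ∃ λ m → iterate f m u ≡ v

    iterate-+ : ∀ k m u → iterate f (k + m) u ≡ iterate f k (iterate f m u)
    iterate-+ zero    m u = refl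
    iterate-+ (suc k) m u = cong f (iterate-+ k m u)

    ⟶*-refl : ∀ {u} → u ⟶* u
    ⟶*-refl = 0 , refl

    ⟶*-step : ∀ u → u ⟶* f u
    ⟶*-step u = 1 , refl

    ⟶*-trans : ∀ {u v w} → u ⟶* v → v ⟶* w → u ⟶* w
    ⟶*-trans {u} (k , fᵏu≡v) (l , fˡv≡w) = l + k , trans (iterate-+ l k u) (trans (cong (iterate f l) fᵏu≡v) fˡv≡w)

    -- Two of the first n + 1 iterates coincide, which shortens any longer walk.
    iterate-shortcut : ∀ m u → ∃ λ (j : Fin n) → iterate f (toℕ j) u ≡ iterate f m u
    iterate-shortcut = <-rec _ shortcut
      where
      shortcut : ∀ m → (∀ {m′} → m′ < m → ∀ u → ∃ λ (j : Fin n) → iterate f (toℕ j) u ≡ iterate f m′ u) →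
                 ∀ u → ∃ λ (j : Fin n) → iterate f (toℕ j) u ≡ iterate f m u
      shortcut m rec u with m <? n
      ... | yes m<n = fromℕ< m<n , cong (λ k → iterate f k u) (toℕ-fromℕ< m<n)
      ... | no m≮n with pigeonhole (n<1+n n) (λ (j : Fin (suc n)) → iterate f (toℕ j) u)
      ...   | i , j , i<j , fⁱu≡fʲu = let (k , fᵏu≡) = rec shorter u in k , trans fᵏu≡ same
        where
        j≤m : toℕ j ≤ m
        j≤m = ≤-trans (toℕ≤pred[n] j) (≮⇒≥ m≮n)
        shorter : m ∸ toℕ j + toℕ i < m
        shorter = ≡.subst (m ∸ toℕ j + toℕ i <_) (m∸n+n≡m j≤m) (+-monoʳ-< (m ∸ toℕ j) i<j)
        same : iterate f (m ∸ toℕ j + toℕ i) u ≡ iterate f m u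
        same = begin
          iterate f (m ∸ toℕ j + toℕ i) u           ≡⟨ iterate-+ (m ∸ toℕ j) (toℕ i) u ⟩
          iterate f (m ∸ toℕ j) (iterate f (toℕ i) u) ≡⟨ cong (iterate f (m ∸ toℕ j)) fⁱu≡fʲu ⟩
          iterate f (m ∸ toℕ j) (iterate f (toℕ j) u) ≡⟨ iterate-+ (m ∸ toℕ j) (toℕ j) u ⟨
          iterate f (m ∸ toℕ j + toℕ j) u           ≡⟨ cong (λ k → iterate f k u) (m∸n+n≡m j≤m) ⟩
          iterate f m u                               ∎

    _⟶*?_ : Decidable _⟶*_
    u ⟶*? v = map′ (λ (j , fʲu≡v) → toℕ j , fʲu≡v)
                   (λ (m , fᵐu≡v) → let (j , fʲu≡fᵐu) = iterate-shortcut m u in j , trans fʲu≡fᵐu fᵐu≡v)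
                   (any? λ j → iterate f (toℕ j) u ≟ v)

    -- The junk value v when v has no preimage never occurs for injective f.
    f⁻¹ : Fin n → Fin n
    f⁻¹ v with any? (λ w → f w ≟ v)
    ... | yes (w , _) = w
    ... | no _        = v

    module _ (f-injective : ∀ u v → f u ≡ f v → u ≡ v) where

      iterate-injective : ∀ k {u v} → iterate f k u ≡ iterate f k v → u ≡ v
      iterate-injective zero    fᵏu≡fᵏv = fᵏu≡fᵏv
      iterate-injective (suc k) fᵏu≡fᵏv = iterate-injective k (f-injective _ _ fᵏu≡fᵏv)

      period : ∀ u → ∃ λ p → iterate f (suc p) u ≡ u
      period u with pigeonhole (n<1+n n) (λ (j : Fin (suc n)) → iterate f (toℕ j) u)
      ... | i , j , i<j , fⁱu≡fʲu with m≤n⇒∃[o]m+o≡n i<j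
      ...   | o , i+1+o≡j = o , sym (iterate-injective (toℕ i) (begin
        iterate f (toℕ i) u                       ≡⟨ fⁱu≡fʲu ⟩
        iterate f (toℕ j) u                       ≡⟨ cong (λ k → iterate f k u) (trans (+-suc (toℕ i) o) i+1+o≡j) ⟨
        iterate f (toℕ i + suc o) u               ≡⟨ iterate-+ (toℕ i) (suc o) u ⟩
        iterate f (toℕ i) (iterate f (suc o) u)   ∎))

      iterate-periodic : ∀ {p u} → iterate f p u ≡ u → ∀ k → iterate f (k * p) u ≡ u
      iterate-periodic         fᵖu≡u zero    = refl
      iterate-periodic {p} {u} fᵖu≡u (suc k) =
        trans (iterate-+ p (k * p) u) (trans (cong (iterate f p) (iterate-periodic fᵖu≡u k)) fᵖu≡u)

      ⟶*-sym : ∀ {u v} → u ⟶* v → v ⟶* u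
      ⟶*-sym {u} {v} (m , fᵐu≡v) with period u
      ... | p , fᵖ⁺¹u≡u = m * p , (begin
        iterate f (m * p) v                 ≡⟨ cong (iterate f (m * p)) fᵐu≡v ⟨
        iterate f (m * p) (iterate f m u)   ≡⟨ iterate-+ (m * p) m u ⟨
        iterate f (m * p + m) u             ≡⟨ cong (λ k → iterate f k u) (trans (+-comm (m * p) m) (sym (*-suc m p))) ⟩
        iterate f (m * suc p) u             ≡⟨ iterate-periodic fᵖ⁺¹u≡u m ⟩
        u                                   ∎)

      f∘f⁻¹ : ∀ v → f (f⁻¹ v) ≡ v
      f∘f⁻¹ v with any? (λ w → f w ≟ v)
      ... | yes (w , fw≡v) = fw≡v
      ... | no ∄preimage with period v
      ...   | p , fᵖ⁺¹v≡v = contradiction (iterate f p v , fᵖ⁺¹v≡v) ∄preimage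

      f⁻¹∘f : ∀ u → f⁻¹ (f u) ≡ u
      f⁻¹∘f u = f-injective _ _ (f∘f⁻¹ (f u))

      ⟶*-f⁻¹ : ∀ v → v ⟶* f⁻¹ v
      ⟶*-f⁻¹ v = ⟶*-sym (1 , f∘f⁻¹ v)

  ⟶*-mono : ∀ {n} {f g : Fin n → Fin n} → (∀ v → Orbits._⟶*_ f v (g v)) →
            ∀ {u w} → Orbits._⟶*_ g u w → Orbits._⟶*_ f u w
  ⟶*-mono {f = f} g⊆f* (zero  , refl) = Orbits.⟶*-refl f
  ⟶*-mono {f = f} g⊆f* (suc m , refl) = Orbits.⟶*-trans f (⟶*-mono g⊆f* (m , refl)) (g⊆f* _)

  -- Reversing the f-cycles through the vertices of an f-invariant set S.
  module Reversal {n} (f : Fin n → Fin n) {S : Fin n → Set} (S? : ∀ v → Dec (S v)) where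
    open Orbits f

    source target reversed : Fin n → Fin n
    source   v = if does (S? v) then f⁻¹ v else v
    target   v = if does (S? v) then f v   else v
    reversed v = if does (S? v) then f⁻¹ v else f v

    module Properties (f-injective : ∀ u v → f u ≡ f v → u ≡ v) (S-f : ∀ {v} → S v → S (f v)) where

      S-⟶* : ∀ {u w} → S u → u ⟶* w → S w
      S-⟶* Su (zero  , refl) = Su
      S-⟶* Su (suc m , refl) = S-f (S-⟶* Su (m , refl))

      S-f⁻¹ : ∀ {v} → S v → S (f⁻¹ v)
      S-f⁻¹ {v} Sv = S-⟶* Sv (⟶*-f⁻¹ f-injective v)

      S-f⁻ : ∀ {v} → S (f v) → S v
      S-f⁻ {v} Sfv = ≡.subst S (f⁻¹∘f f-injective v) (S-f⁻¹ Sfv)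

      source∘f : ∀ {v} → S v → source (f v) ≡ v
      source∘f {v} Sv = trans (if-yes (S? (f v)) (S-f Sv)) (f⁻¹∘f f-injective v)

      reversed∘f : ∀ {v} → S v → reversed (f v) ≡ v
      reversed∘f {v} Sv = trans (if-yes (S? (f v)) (S-f Sv)) (f⁻¹∘f f-injective v)

      source∘target : ∀ v → source (target v) ≡ v
      source∘target v with S? v
      ... | yes Sv = source∘f Sv
      ... | no ¬Sv = if-no (S? v) ¬Sv

      target∘source : ∀ v → target (source v) ≡ v
      target∘source v with S? v
      ... | yes Sv = trans (if-yes (S? (f⁻¹ v)) (S-f⁻¹ Sv)) (f∘f⁻¹ f-injective v)
      ... | no ¬Sv = if-no (S? v) ¬Sv

      reversed-arc : ∀ v → (¬ S v × source v ≡ v × reversed v ≡ f v) ⊎ (S v × f (source v) ≡ v × reversed v ≡ source v)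
      reversed-arc v with S? v
      ... | yes Sv = inj₂ (Sv , f∘f⁻¹ f-injective v , refl)
      ... | no ¬Sv = inj₁ (¬Sv , refl , refl)

      reversed-injective : ∀ u v → reversed u ≡ reversed v → u ≡ v
      reversed-injective u v eq with S? u | S? v
      ... | yes Su | yes Sv = trans (sym (f∘f⁻¹ f-injective u)) (trans (cong f eq) (f∘f⁻¹ f-injective v))
      ... | no ¬Su | no ¬Sv = f-injective u v eq
      ... | yes Su | no ¬Sv = contradiction (S-f⁻ (≡.subst S eq (S-f⁻¹ Su))) ¬Sv
      ... | no ¬Su | yes Sv = contradiction (S-f⁻ (≡.subst S (sym eq) (S-f⁻¹ Sv))) ¬Su

      ⟶*-reversed⇒⟶* : ∀ {u w} → Orbits._⟶*_ reversed u w → u ⟶* w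
      ⟶*-reversed⇒⟶* = ⟶*-mono v⟶*reversed
        where
        v⟶*reversed : ∀ v → v ⟶* reversed v
        v⟶*reversed v with S? v
        ... | yes _ = ⟶*-f⁻¹ f-injective v
        ... | no  _ = ⟶*-step v

      ⟶*⇒⟶*-reversed : ∀ {u w} → u ⟶* w → Orbits._⟶*_ reversed u w
      ⟶*⇒⟶*-reversed = ⟶*-mono v⟶*f
        where
        v⟶*f : ∀ v → Orbits._⟶*_ reversed v (f v)
        v⟶*f v with S? v
        ... | yes Sv = Orbits.⟶*-sym reversed reversed-injective (1 , reversed∘f Sv)
        ... | no ¬Sv = 1 , if-no (S? v) ¬Sv

  -- Reversing the same cycles once more, in any presentation g of the reversed function.
  module ReversalTwice {n} (f : Fin n → Fin n) {S : Fin n → Set} (S? : ∀ v → Dec (S v))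
    (f-injective : ∀ u v → f u ≡ f v → u ≡ v) (S-f : ∀ {v} → S v → S (f v))
    (g : Fin n → Fin n) (g≗reversed : ∀ v → g v ≡ Reversal.reversed f S? v)
    {S′ : Fin n → Set} (S′? : ∀ v → Dec (S′ v)) (S′→S : ∀ {v} → S′ v → S v) (S→S′ : ∀ {v} → S v → S′ v) where
    open Orbits f
    open Reversal f S?
    open Properties f-injective S-f

    g-injective : ∀ u v → g u ≡ g v → u ≡ v
    g-injective u v eq = reversed-injective u v (trans (sym (g≗reversed u)) (trans eq (g≗reversed v)))

    g⁻¹-S : ∀ {v} → S v → Orbits.f⁻¹ g v ≡ f v
    g⁻¹-S {v} Sv = begin
      Orbits.f⁻¹ g v           ≡⟨ cong (Orbits.f⁻¹ g) (trans (g≗reversed (f v)) (reversed∘f Sv)) ⟨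
      Orbits.f⁻¹ g (g (f v))   ≡⟨ Orbits.f⁻¹∘f g g-injective (f v) ⟩
      f v                      ∎

    reversed-twice : ∀ v → Reversal.reversed g S′? v ≡ f v
    reversed-twice v with S? v
    ... | yes Sv = trans (if-yes (S′? v) (S→S′ Sv)) (g⁻¹-S Sv)
    ... | no ¬Sv = trans (if-no (S′? v) (¬Sv ∘ S′→S)) (trans (g≗reversed v) (if-no (S? v) ¬Sv))

    source-twice : ∀ v → source (Reversal.source g S′? v) ≡ v
    source-twice v with S? v
    ... | yes Sv = trans (cong source (trans (if-yes (S′? v) (S→S′ Sv)) (g⁻¹-S Sv))) (source∘f Sv)
    ... | no ¬Sv = trans (cong source (if-no (S′? v) (¬Sv ∘ S′→S))) (if-no (S? v) ¬Sv)

module CycleCovers where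

  open import Data.Nat using (ℕ; zero; suc; _+_)
  open import Data.Fin using (Fin; zero; suc; _≟_)
  open import Data.Fin.Properties using (any?)
  open import Data.Bool using (Bool; if_then_else_)
  open import Data.Product using (∃; _×_; _,_; proj₁; proj₂)
  open import Data.Sum using (inj₁; inj₂)
  open import Data.Empty using (⊥)
  open import Data.Vec using (tabulate)
  open import Data.Vec.Properties as Vec using (lookup∘tabulate; tabulate∘lookup; tabulate-cong)
  open import Function using (_∘_)
  open import Relation.Nullary using (Dec; yes; no; ¬_; contradiction)
  open import Relation.Nullary.Decidable using (map′; _×-dec_; ¬?)
  open import Relation.Binary.Definitions using (DecidableEquality)
  open import Relation.Binary.PropositionalEquality as ≡ using (_≡_; refl; sym; trans; cong; subst)
  open FunctionalGraphs

  open import Data.Fin.Permutation using (Permutation; permutation; _⟨$⟩ʳ_)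
  open import Data.Nat.Properties using (+-0-commutativeMonoid)
  open import Algebra.Properties.CommutativeMonoid.Sum +-0-commutativeMonoid using ()
    renaming (sum to ∑ℕ; sum-permute to ∑ℕ-permute)
  import Data.Integer as ℤ

  _≟ₖ_ : DecidableEquality Kind
  loop    ≟ₖ loop    = yes refl
  rainbow ≟ₖ rainbow = yes refl
  extra   ≟ₖ extra   = yes refl
  loop    ≟ₖ rainbow = no λ ()
  loop    ≟ₖ extra   = no λ ()
  rainbow ≟ₖ loop    = no λ ()
  rainbow ≟ₖ extra   = no λ ()
  extra   ≟ₖ loop    = no λ ()
  extra   ≟ₖ rainbow = no λ ()

  _≟-cover_ : ∀ {n} → DecidableEquality (Cover n)
  mkCover ns ks ≟-cover mkCover ns′ ks′ =
    map′ (λ (ns≡ , ks≡) → ≡.cong₂ mkCover ns≡ ks≡) (λ K≡K′ → cong Cover.nextV K≡K′ , cong Cover.kindV K≡K′)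
         (Vec.≡-dec _≟_ ns ns′ ×-dec Vec.≡-dec _≟ₖ_ ks ks′)

  sumℕ≡∑ℕ : ∀ {N} (g : Fin N → ℕ) → sumℕ g ≡ ∑ℕ g
  sumℕ≡∑ℕ {zero}  g = refl
  sumℕ≡∑ℕ {suc N} g = cong (g zero +_) (sumℕ≡∑ℕ (g ∘ suc))

  count≡∑ℕ : ∀ {N} (p : Fin N → Bool) → count p ≡ ∑ℕ (λ u → if p u then 1 else 0)
  count≡∑ℕ {zero}  p = refl
  count≡∑ℕ {suc N} p = cong ((if p zero then 1 else 0) +_) (count≡∑ℕ (p ∘ suc))

  sumℕ-permute : ∀ {N} (g : Fin N → ℕ) (π : Permutation N N) → sumℕ g ≡ sumℕ (g ∘ (π ⟨$⟩ʳ_))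
  sumℕ-permute g π = trans (sumℕ≡∑ℕ g) (trans (∑ℕ-permute g π) (sym (sumℕ≡∑ℕ (g ∘ (π ⟨$⟩ʳ_)))))

  count-permute : ∀ {N} (p : Fin N → Bool) (π : Permutation N N) → count p ≡ count (p ∘ (π ⟨$⟩ʳ_))
  count-permute p π = trans (count≡∑ℕ p) (trans (∑ℕ-permute _ π) (sym (count≡∑ℕ (p ∘ (π ⟨$⟩ʳ_)))))

  sumℕ-cong : ∀ {N} {g h : Fin N → ℕ} → (∀ u → g u ≡ h u) → sumℕ g ≡ sumℕ h
  sumℕ-cong {zero}  g≗h = refl
  sumℕ-cong {suc N} g≗h = ≡.cong₂ _+_ (g≗h zero) (sumℕ-cong (g≗h ∘ suc))

  count-cong : ∀ {N} {p q : Fin N → Bool} → (∀ u → p u ≡ q u) → count p ≡ count q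
  count-cong {zero}  p≗q = refl
  count-cong {suc N} p≗q = ≡.cong₂ _+_ (cong (if_then 1 else 0) (p≗q zero)) (count-cong (p≗q ∘ suc))

  module DefectiveCycles (I : Instance) where
    open Instance I

    IsArc-reverse : ∀ {u v κ} → IsArc I u v κ → ¬ (κ ≡ rainbow × u ≡ v₁ × v ≡ v₂) → IsArc I v u κ
    IsArc-reverse {κ = loop}    (v≡u , u≢v₁ , u≢v₂) _ = sym v≡u , u≢v₁ ∘ subst _ v≡u , u≢v₂ ∘ subst _ v≡u
    IsArc-reverse {κ = rainbow} (uv∈E , _) ¬v₁v₂ = Adj-sym uv∈E , λ (v≡v₂ , u≡v₁) → ¬v₁v₂ (refl , u≡v₁ , v≡v₂)
    IsArc-reverse {κ = extra}   (uv∈E , ¬v₁v₂) _ = Adj-sym uv∈E , λ { (inj₁ (v≡v₁ , u≡v₂)) → ¬v₁v₂ (inj₂ (u≡v₂ , v≡v₁))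
                                                                  ; (inj₂ (v≡v₂ , u≡v₁)) → ¬v₁v₂ (inj₁ (u≡v₁ , v≡v₂)) }

    module _ (K : Cover n) where
      open Cover K
      open Orbits next

      OnDefectiveCycle : Fin n → Set
      OnDefectiveCycle v = (∃ λ w → v ⟶* w × kind w ≡ rainbow) × ¬ CycleThroughContains-v₁v₂ I K v

      cycleThroughContains-v₁v₂? : ∀ v → Dec (CycleThroughContains-v₁v₂ I K v)
      cycleThroughContains-v₁v₂? v =
        map′ (λ ((m , fᵐv≡v₁) , v₁⟶v₂ , rb) → m , fᵐv≡v₁ , v₁⟶v₂ , rb) (λ (m , fᵐv≡v₁ , v₁⟶v₂ , rb) → (m , fᵐv≡v₁) , v₁⟶v₂ , rb)
             ((v ⟶*? v₁) ×-dec (next v₁ ≟ v₂) ×-dec (kind v₁ ≟ₖ rainbow))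

      onDefectiveCycle? : ∀ v → Dec (OnDefectiveCycle v)
      onDefectiveCycle? v = any? (λ w → (v ⟶*? w) ×-dec (kind w ≟ₖ rainbow)) ×-dec ¬? (cycleThroughContains-v₁v₂? v)

    reverseDefectiveCycles : Cover n → Cover n
    reverseDefectiveCycles K = mkCover (tabulate reversed) (tabulate (kind ∘ source))
      where open Cover K
            open Reversal next (onDefectiveCycle? K)

    module ReversalOf (K : Cover n) (K-cover : IsCycleCover I K) where
      open Cover K
      open Orbits next
      private
        arcs = proj₁ K-cover
        next-injective = proj₂ K-cover
        S = OnDefectiveCycle K

      OnDefectiveCycle-⟶* : ∀ {u w} → u ⟶* w → S u → S w
      OnDefectiveCycle-⟶* u⟶*w ((x , u⟶*x , rb) , ¬ct) =
        (x , ⟶*-trans (⟶*-sym next-injective u⟶*w) u⟶*x , rb) ,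
        λ (m , fᵐw≡v₁ , v₁⟶v₂ , rb₁) → let (l , fˡu≡v₁) = ⟶*-trans u⟶*w (m , fᵐw≡v₁) in ¬ct (l , fˡu≡v₁ , v₁⟶v₂ , rb₁)

      S-next : ∀ {v} → S v → S (next v)
      S-next {v} = OnDefectiveCycle-⟶* (⟶*-step v)

      open Reversal next (onDefectiveCycle? K) public
      open Properties next-injective S-next public

      K′ : Cover n
      K′ = reverseDefectiveCycles K

      next′≗reversed : ∀ v → Cover.next K′ v ≡ reversed v
      next′≗reversed = lookup∘tabulate reversed

      kind′≗kind∘source : ∀ v → Cover.kind K′ v ≡ kind (source v)
      kind′≗kind∘source = lookup∘tabulate (kind ∘ source)

      -- The arc of K′ out of v is the arc of K out of source v, possibly reversed.
      arcwise : ∀ {a ℓ} {A : Set a} (_∼_ : A → A → Set ℓ) → (∀ {x} → x ∼ x) → (Φ : Fin n → Fin n → Kind → A) →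
                (∀ {u v κ} → IsArc I u v κ → Φ v u κ ∼ Φ u v κ) →
                ∀ v → Φ v (Cover.next K′ v) (Cover.kind K′ v) ∼ Φ (source v) (next (source v)) (kind (source v))
      arcwise _∼_ ∼-refl Φ Φ-reverse v rewrite next′≗reversed v | kind′≗kind∘source v with reversed-arc v
      ... | inj₁ (_ , s≡v , r≡f) rewrite s≡v | r≡f = ∼-refl
      ... | inj₂ (_ , fs≡v , r≡s) rewrite r≡s = subst (λ x → Φ v (source v) κ ∼ Φ (source v) x κ) (sym fs≡v)
                                                      (Φ-reverse (subst (λ x → IsArc I (source v) x κ) fs≡v (arcs (source v))))
        where κ = kind (source v)

      K′-arcs : ∀ v → IsArc I v (Cover.next K′ v) (Cover.kind K′ v)
      K′-arcs v rewrite next′≗reversed v | kind′≗kind∘source v with reversed-arc v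
      ... | inj₁ (_ , s≡v , r≡f) rewrite s≡v | r≡f = arcs v
      ... | inj₂ (Sv , fs≡v , r≡s) rewrite r≡s =
        IsArc-reverse (subst (λ x → IsArc I u x (kind u)) fs≡v (arcs u))
                      (λ (rb , u≡v₁ , v≡v₂) → proj₂ Su (0 , u≡v₁ , subst (λ x → next x ≡ v₂) u≡v₁ (trans fs≡v v≡v₂) ,
                                                        subst (λ x → kind x ≡ rainbow) u≡v₁ rb))
        where
        u = source v
        Su : S u
        Su = S-f⁻ (subst S (sym fs≡v) Sv)

      K′-injective : ∀ u w → Cover.next K′ u ≡ Cover.next K′ w → u ≡ w
      K′-injective u w eq = reversed-injective u w (trans (sym (next′≗reversed u)) (trans eq (next′≗reversed w)))

      K′-cover : IsCycleCover I K′
      K′-cover = K′-arcs , K′-injective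

      ⟶*′⇒⟶* : ∀ {u w} → Orbits._⟶*_ (Cover.next K′) u w → u ⟶* w
      ⟶*′⇒⟶* = ⟶*-reversed⇒⟶* ∘ ⟶*-mono (λ v → 1 , sym (next′≗reversed v))

      ⟶*⇒⟶*′ : ∀ {u w} → u ⟶* w → Orbits._⟶*_ (Cover.next K′) u w
      ⟶*⇒⟶*′ = ⟶*-mono (λ v → 1 , next′≗reversed v) ∘ ⟶*⇒⟶*-reversed

      untouched : ∀ {v} → ¬ S v → Cover.next K′ v ≡ next v × Cover.kind K′ v ≡ kind v
      untouched {v} ¬Sv with reversed-arc v
      ... | inj₁ (_ , s≡v , r≡f) = trans (next′≗reversed v) r≡f , trans (kind′≗kind∘source v) (cong kind s≡v)
      ... | inj₂ (Sv , _) = contradiction Sv ¬Sv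

      OnDefectiveCycle-K′⁺ : ∀ {v} → S v → OnDefectiveCycle K′ v
      OnDefectiveCycle-K′⁺ {v} Sv@((w , v⟶*w , rb) , _) =
        (next w , ⟶*⇒⟶*′ (⟶*-trans v⟶*w (⟶*-step w)) , trans (kind′≗kind∘source (next w)) (trans (cong kind (source∘f Sw)) rb)) ,
        λ (m , fᵐv≡v₁ , v₁⟶v₂ , rb₁) → no-v₁v₂ (OnDefectiveCycle-⟶* (⟶*′⇒⟶* (m , fᵐv≡v₁)) Sv) v₁⟶v₂ rb₁
        where
        Sw = OnDefectiveCycle-⟶* v⟶*w Sv
        no-v₁v₂ : S v₁ → Cover.next K′ v₁ ≡ v₂ → Cover.kind K′ v₁ ≡ rainbow → ⊥
        no-v₁v₂ Sv₁ v₁⟶′v₂ rb₁ with reversed-arc v₁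
        ... | inj₁ (¬Sv₁ , _) = contradiction Sv₁ ¬Sv₁
        ... | inj₂ (_ , fs≡v₁ , r≡s) =
          proj₂ (subst (λ x → IsArc I (source v₁) x rainbow) fs≡v₁
                       (subst (IsArc I (source v₁) (next (source v₁))) (trans (sym (kind′≗kind∘source v₁)) rb₁) (arcs (source v₁))))
                (trans (sym r≡s) (trans (sym (next′≗reversed v₁)) v₁⟶′v₂) , refl)

      OnDefectiveCycle-K′⁻ : ∀ {v} → OnDefectiveCycle K′ v → S v
      OnDefectiveCycle-K′⁻ {v} S′v with onDefectiveCycle? K v
      ... | yes Sv = Sv
      ... | no ¬Sv =
        (w , v⟶*w , trans (sym (proj₂ (untouched (¬S v⟶*w)))) rb′) ,
        λ (m , fᵐv≡v₁ , v₁⟶v₂ , rb₁) →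
          let (m′ , f′ᵐ′v≡v₁) = ⟶*⇒⟶*′ (m , fᵐv≡v₁)
              (n′≡n , k′≡k) = untouched (¬S (m , fᵐv≡v₁))
          in ¬ct′ (m′ , f′ᵐ′v≡v₁ , trans n′≡n v₁⟶v₂ , trans k′≡k rb₁)
        where
        w = proj₁ (proj₁ S′v)
        v⟶*w = ⟶*′⇒⟶* (proj₁ (proj₂ (proj₁ S′v)))
        rb′ = proj₂ (proj₂ (proj₁ S′v))
        ¬ct′ = proj₂ S′v
        ¬S : ∀ {x} → v ⟶* x → ¬ S x
        ¬S v⟶*x Sx = ¬Sv (OnDefectiveCycle-⟶* (⟶*-sym next-injective v⟶*x) Sx)

      reverse-involutive : reverseDefectiveCycles K′ ≡ K
      reverse-involutive =
        ≡.cong₂ mkCover (trans (tabulate-cong reversed-twice) (tabulate∘lookup nextV))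
                        (trans (tabulate-cong (λ v → trans (kind′≗kind∘source _) (cong kind (source-twice v)))) (tabulate∘lookup kindV))
        where open ReversalTwice next (onDefectiveCycle? K) next-injective S-next (Cover.next K′) next′≗reversed
                                 (onDefectiveCycle? K′) OnDefectiveCycle-K′⁻ OnDefectiveCycle-K′⁺

      sourcePermutation : Permutation n n
      sourcePermutation = permutation source target source∘target target∘source

      weightTerm : Fin n → Fin n → Kind → ℕ
      weightTerm u v κ = if isRainbow κ then bitℕ (weight u v) else 0

      weightTerm-reverse : ∀ {u v κ} → IsArc I u v κ → weightTerm v u κ ≡ weightTerm u v κ
      weightTerm-reverse {κ = loop}    _          = refl
      weightTerm-reverse {κ = rainbow} (uv∈E , _) = cong bitℕ (weight-sym (Adj-sym uv∈E))
      weightTerm-reverse {κ = extra}   _          = refl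

      count-kind′ : ∀ (p : Kind → Bool) → count (p ∘ Cover.kind K′) ≡ count (p ∘ kind)
      count-kind′ p = trans (count-cong (cong p ∘ kind′≗kind∘source)) (sym (count-permute (p ∘ kind) sourcePermutation))

      InC-reverse : ∀ {i} → InC I i K → InC I i K′
      InC-reverse (_ , #rainbow , weight-sum , #loop) =
        K′-cover , trans (count-kind′ isRainbow) #rainbow ,
        trans (cong ℤ.+_ (trans (sumℕ-cong (arcwise _≡_ refl weightTerm weightTerm-reverse))
                              (sym (sumℕ-permute (λ u → weightTerm u (next u) (kind u)) sourcePermutation)))) weight-sum ,
        trans (count-kind′ isLoop) #loop

      module _ (K-defective : HasDefectiveCycle I K) where
        private
          u₀ = proj₁ K-defective
          Su₀ : S u₀
          Su₀ = (u₀ , ⟶*-refl , proj₁ (proj₂ K-defective)) , proj₂ (proj₂ K-defective)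

        K′-defective : HasDefectiveCycle I K′
        K′-defective = next u₀ , trans (kind′≗kind∘source _) (trans (cong kind (source∘f Su₀)) (proj₁ (proj₂ K-defective))) ,
                       proj₂ (OnDefectiveCycle-K′⁺ (S-next Su₀))

        fixed⇒rainbow-2-cycle : K′ ≡ K → ∃ λ u → kind u ≡ rainbow × kind (next u) ≡ rainbow × next (next u) ≡ u
        fixed⇒rainbow-2-cycle K′≡K =
          u₀ , proj₁ (proj₂ K-defective) ,
          trans (cong (λ L → Cover.kind L (next u₀)) (sym K′≡K)) (proj₁ (proj₂ K′-defective)) ,
          trans (cong (λ L → Cover.next L (next u₀)) (sym K′≡K)) (trans (next′≗reversed _) (reversed∘f Su₀))

      InD-reverse : ∀ {i} → InD I i K → InD I i K′
      InD-reverse {i} (K∈𝒞 , K-defective) = InC-reverse {i} K∈𝒞 , K′-defective K-defective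

module ArcLabels where

  open import Data.Nat using (ℕ; zero; suc; _≤_)
  open import Data.Nat.Properties using (≤-reflexive)
  open import Data.Fin using (Fin; zero; suc; _<?_)
  open import Data.Fin.Properties using (<-cmp)
  open import Data.Bool using (Bool; true; false; not; if_then_else_; _xor_)
  open import Data.Bool.Properties using (not-involutive)
  open import Data.List using (List; []; _∷_; foldr)
  open import Data.Maybe using (Maybe; just; nothing; is-just)
  open import Data.Maybe.Relation.Binary.Pointwise as Maybeᴾ using (just; nothing)
  open import Data.Product using (_,_; proj₁)
  open import Function using (_∘_)
  open import Data.Vec.Functional using () renaming (_∷_ to _◃_)
  open import Relation.Nullary using (does; ¬_; contradiction)
  open import Relation.Nullary.Decidable using (dec-true; dec-false)
  open import Relation.Binary using (tri<; tri≈; tri>)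
  open import Relation.Binary.PropositionalEquality as ≡ using (_≡_; _≢_)
  import Algebra.Properties.CommutativeMonoid.Sum as CommutativeMonoidSum
  open BooleanCube
  open CycleCovers

  orientation-reverse : ∀ {n} {u v : Fin n} → u ≢ v → ∀ d →
                        (if does (v <? u) then d else not d) ≡ not (if does (u <? v) then d else not d)
  orientation-reverse {u = u} {v} u≢v d with <-cmp u v
  ... | tri< u<v _ v≮u rewrite dec-true (u <? v) u<v | dec-false (v <? u) v≮u = ≡.refl
  ... | tri≈ _ u≡v _   = contradiction u≡v u≢v
  ... | tri> u≮v _ v<u rewrite dec-false (u <? v) u≮v | dec-true (v <? u) v<u = ≡.sym (not-involutive d)

  if-not≡xor : ∀ c d → (if c then d else not d) ≡ d xor not c
  if-not≡xor true  false = ≡.refl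
  if-not≡xor true  true  = ≡.refl
  if-not≡xor false false = ≡.refl
  if-not≡xor false true  = ≡.refl

  module Labels (I : Instance) (Rg : CommutativeRing 0ℓ 0ℓ)
    (1+1≈0 : CommutativeRing._≈_ Rg (CommutativeRing._+_ Rg (CommutativeRing.1# Rg) (CommutativeRing.1# Rg)) (CommutativeRing.0# Rg))
    (ν : Assignment I Rg) (A : Fin (Instance.s I) → Fin (Instance.k I) → Bool) where
    open Instance I
    open CommutativeRing Rg hiding (zero)
    open import Relation.Binary.Reasoning.Setoid setoid
    open Assignment ν
    open CubeSum Rg
    open CharacteristicTwo Rg 1+1≈0
    open CommutativeMonoidSum *-commutativeMonoid using ()
      renaming (sum to ∏; sum-cong-≋ to ∏-cong; ∑-distrib-+ to ∏-distrib-*; sum-permute to ∏-permute)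
    open DefectiveCycles I

    fromBool≡𝟙 : ∀ x → fromBool I Rg ν x ≡ 𝟙 x
    fromBool≡𝟙 true  = ≡.refl
    fromBool≡𝟙 false = ≡.refl

    prodV≡∏ : ∀ {N} (g : Fin N → Carrier) → prodV I Rg ν g ≡ ∏ g
    prodV≡∏ {zero}  g = ≡.refl
    prodV≡∏ {suc N} g = ≡.cong (g zero *_) (prodV≡∏ (g ∘ suc))

    sumBits≡∑𝔹 : ∀ {m} (F : Cube m → Carrier) → sumBits I Rg ν F ≡ ∑𝔹 F
    sumBits≡∑𝔹 {zero}  F = ≡.refl
    sumBits≡∑𝔹 {suc m} F = ≡.cong₂ _+_ (sumBits≡∑𝔹 (F ∘ (false ◃_))) (sumBits≡∑𝔹 (F ∘ (true ◃_)))

    sumList≡foldr : ∀ xs → sumList I Rg ν xs ≡ foldr _+_ 0# xs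
    sumList≡foldr []       = ≡.refl
    sumList≡foldr (x ∷ xs) = ≡.cong (x +_) (sumList≡foldr xs)

    bit : Cube k → Fin n → Fin n → Bool
    bit b u v = if does (u <? v) then dot (A (colour u v)) b else not (dot (A (colour u v)) b)

    coefficient : Fin n → Fin n → Kind → Carrier
    coefficient u v loop    = 𝚉
    coefficient u v rainbow = 𝚁 u v * W^ I Rg ν (weight u v)
    coefficient u v extra   = 𝚇 u v * 𝚈

    form : Fin n → Fin n → Kind → Maybe (Affine k)
    form u v rainbow = just (A (colour u v) , not (does (u <? v)))
    form u v _       = nothing

    arcLabel-factorises : ∀ b u v κ → arcLabel I Rg ν A b u v κ ≈ coefficient u v κ * ⟦ form u v κ ⟧? b
    arcLabel-factorises b u v loop    = sym (*-identityʳ 𝚉)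
    arcLabel-factorises b u v extra   = sym (*-identityʳ _)
    arcLabel-factorises b u v rainbow = begin
      fromBool I Rg ν (bit b u v) * 𝚁 u v * W^ I Rg ν (weight u v)
        ≈⟨ *-congʳ (*-congʳ (reflexive (≡.trans (fromBool≡𝟙 (bit b u v)) (≡.cong 𝟙 (if-not≡xor (does (u <? v)) d))))) ⟩
      𝟙 (d xor not (does (u <? v))) * 𝚁 u v * W^ I Rg ν (weight u v)
        ≈⟨ trans (*-assoc _ _ _) (*-comm _ _) ⟩
      𝚁 u v * W^ I Rg ν (weight u v) * 𝟙 (d xor not (does (u <? v))) ∎
      where d = dot (A (colour u v)) b

    coefficient-reverse : ∀ {u v κ} → IsArc I u v κ → coefficient v u κ ≈ coefficient u v κ
    coefficient-reverse {κ = loop}    _          = refl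
    coefficient-reverse {κ = rainbow} (uv∈E , _) =
      *-cong (𝚁-sym (Adj-sym uv∈E)) (reflexive (≡.cong (W^ I Rg ν) (weight-sym (Adj-sym uv∈E))))
    coefficient-reverse {κ = extra}   (uv∈E , _) = *-congʳ (𝚇-sym (Adj-sym uv∈E))

    form-reverse : ∀ {u v κ} → IsArc I u v κ → Maybeᴾ.Pointwise SameLinear (form v u κ) (form u v κ)
    form-reverse {κ = loop}    _          = nothing
    form-reverse {κ = rainbow} (uv∈E , _) = just (≡.cong A (colour-sym (Adj-sym uv∈E)))
    form-reverse {κ = extra}   _          = nothing

    is-just∘form : ∀ u v κ → is-just (form u v κ) ≡ isRainbow κ
    is-just∘form u v loop    = ≡.refl
    is-just∘form u v rainbow = ≡.refl
    is-just∘form u v extra   = ≡.refl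

    module _ (K : Cover n) where
      open Cover K

      coefficients : Fin n → Carrier
      coefficients u = coefficient u (next u) (kind u)

      forms : Fin n → Maybe (Affine k)
      forms u = form u (next u) (kind u)

      labels : Cube k → Fin n → Carrier
      labels b u = arcLabel I Rg ν A b u (next u) (kind u)

      formValues : Cube k → Fin n → Carrier
      formValues b u = ⟦ forms u ⟧? b

      Λ-factorises : Λ I Rg ν A K ≈ ∏ coefficients * ∑𝔹 (∏ ∘ formValues)
      Λ-factorises = begin
        Λ I Rg ν A K                                    ≡⟨ sumBits≡∑𝔹 (λ b → prodV I Rg ν (labels b)) ⟩
        ∑𝔹 (λ b → prodV I Rg ν (labels b))            ≈⟨ ∑𝔹-cong (λ b → reflexive (prodV≡∏ (labels b))) ⟩
        ∑𝔹 (λ b → ∏ (labels b))                       ≈⟨ ∑𝔹-cong ∏labels≈ ⟩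
        ∑𝔹 (λ b → ∏ coefficients * ∏ (formValues b))  ≈⟨ ∑𝔹-*ˡ (∏ coefficients) (∏ ∘ formValues) ⟩
        ∏ coefficients * ∑𝔹 (∏ ∘ formValues)          ∎
        where
        ∏labels≈ : ∀ b → ∏ (labels b) ≈ ∏ coefficients * ∏ (formValues b)
        ∏labels≈ b = trans (∏-cong (λ u → arcLabel-factorises b u (next u) (kind u))) (∏-distrib-* coefficients (formValues b))

    Λ-reverse : ∀ K → IsCycleCover I K → count (isRainbow ∘ Cover.kind K) ≡ k →
                Λ I Rg ν A (reverseDefectiveCycles K) ≈ Λ I Rg ν A K
    Λ-reverse K K-cover #rainbow = begin
      Λ I Rg ν A K′                                   ≈⟨ Λ-factorises K′ ⟩
      ∏ (coefficients K′) * ∑𝔹 (∏ ∘ formValues K′)    ≈⟨ *-cong ∏coefficients≈ ∑formValues≈ ⟩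
      ∏ (coefficients K) * ∑𝔹 (∏ ∘ formValues K)      ≈⟨ Λ-factorises K ⟨
      Λ I Rg ν A K                                    ∎
      where
      open ReversalOf K K-cover
      ∏coefficients≈ : ∏ (coefficients K′) ≈ ∏ (coefficients K)
      ∏coefficients≈ = trans (∏-cong (arcwise _≈_ refl coefficient coefficient-reverse))
                             (sym (∏-permute (coefficients K) sourcePermutation))
      #forms′≤k : count (is-just ∘ forms K′) ≤ k
      #forms′≤k = ≤-reflexive (≡.trans (count-cong (λ u → is-just∘form u (Cover.next K′ u) (Cover.kind K′ u)))
                                       (≡.trans (count-kind′ isRainbow) #rainbow))
      ∑formValues≈ : ∑𝔹 (∏ ∘ formValues K′) ≈ ∑𝔹 (∏ ∘ formValues K)
      ∑formValues≈ = trans (∑∏⟦⟧?-invariant (forms K′) (forms K ∘ source)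
                                            (arcwise (Maybeᴾ.Pointwise SameLinear) (λ {x} → Maybeᴾ.refl ≡.refl {x}) form form-reverse)
                                            #forms′≤k)
                           (∑𝔹-cong (λ b → sym (∏-permute (formValues K b) sourcePermutation)))

    bit-reverse : ∀ b {u v} → Adj u v → bit b v u ≡ not (bit b u v)
    bit-reverse b {u} {v} uv∈E =
      ≡.trans (≡.cong (λ c → if does (v <? u) then dot (A c) b else not (dot (A c) b)) (colour-sym (Adj-sym uv∈E)))
              (orientation-reverse (λ u≡v → Adj-irrefl (≡.subst (Adj u) (≡.sym u≡v) uv∈E)) _)

    arcLabel-rainbow-off : ∀ b u v → bit b u v ≡ false → arcLabel I Rg ν A b u v rainbow ≈ 0#
    arcLabel-rainbow-off b u v off =
      trans (*-congʳ (*-congʳ (reflexive (≡.cong (fromBool I Rg ν) off)))) (trans (*-congʳ (zeroˡ _)) (zeroˡ _))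

    ∏-annihilated : ∀ {N} (t : Fin N → Carrier) i → t i ≈ 0# → ∏ t ≈ 0#
    ∏-annihilated t zero    tᵢ≈0 = trans (*-congʳ tᵢ≈0) (zeroˡ _)
    ∏-annihilated t (suc i) tᵢ≈0 = trans (*-congˡ (∏-annihilated (t ∘ suc) i tᵢ≈0)) (zeroʳ _)

    -- The labels of the two arcs of a rainbow 2-cycle carry complementary bits, so one of them vanishes.
    Λ-rainbow-2-cycle : ∀ K → IsCycleCover I K → ∀ {u} → Cover.kind K u ≡ rainbow →
                        Cover.kind K (Cover.next K u) ≡ rainbow → Cover.next K (Cover.next K u) ≡ u → Λ I Rg ν A K ≈ 0#
    Λ-rainbow-2-cycle K (arcs , _) {u} ku≡rb kx≡rb nx≡u =
      trans (reflexive (sumBits≡∑𝔹 (λ b → prodV I Rg ν (labels K b))))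
            (∑𝔹-zero (λ b → trans (reflexive (prodV≡∏ (labels K b))) (∏labels≈0 b)))
      where
      open Cover K
      x = next u
      ux∈E : Adj u x
      ux∈E = proj₁ (≡.subst (IsArc I u x) ku≡rb (arcs u))
      label-off : ∀ b w {y} → next w ≡ y → kind w ≡ rainbow → bit b w y ≡ false → labels K b w ≈ 0#
      label-off b w nw≡y kw≡rb off = trans (reflexive (≡.cong₂ (arcLabel I Rg ν A b w) nw≡y kw≡rb)) (arcLabel-rainbow-off b w _ off)
      ∏labels≈0 : ∀ b → ∏ (labels K b) ≈ 0#
      ∏labels≈0 b with bit b u x in bit≡
      ... | false = ∏-annihilated (labels K b) u (label-off b u ≡.refl ku≡rb bit≡)
      ... | true  = ∏-annihilated (labels K b) x (label-off b x nx≡u kx≡rb (≡.trans (bit-reverse b ux∈E) (≡.cong not bit≡)))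

    Λ-fixed : ∀ K → IsCycleCover I K → HasDefectiveCycle I K → reverseDefectiveCycles K ≡ K → Λ I Rg ν A K ≈ 0#
    Λ-fixed K K-cover K-defective fixed =
      let (_ , ku≡rb , kx≡rb , nx≡u) = ReversalOf.fixed⇒rainbow-2-cycle K K-cover K-defective fixed
      in Λ-rainbow-2-cycle K K-cover ku≡rb kx≡rb nx≡u

open InvolutionSums
open CycleCovers
open ArcLabels

lemma6 : (I : Instance) → (Rg : CommutativeRing 0ℓ 0ℓ) →
         CommutativeRing._≈_ Rg (CommutativeRing._+_ Rg (CommutativeRing.1# Rg) (CommutativeRing.1# Rg)) (CommutativeRing.0# Rg) →
         (ν : Assignment I Rg) →
         (A : Fin (Instance.s I) → Fin (Instance.k I) → Bool) →
         (i : ℕ) → Instance.k I ≤ i → i ≤ Instance.n I →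
         (𝒟 : List (Cover (Instance.n I))) → Unique 𝒟 →
         (∀ K → (K ∈ 𝒟) ⇔ InD I i K) →
         CommutativeRing._≈_ Rg (sumList I Rg ν (map (Λ I Rg ν A) 𝒟)) (CommutativeRing.0# Rg)
lemma6 I Rg 1+1≈0 ν A i _ _ 𝒟 𝒟-unique ∈𝒟⇔InD = begin
  sumList I Rg ν (map (Λ I Rg ν A) 𝒟)  ≡⟨ sumList≡foldr (map (Λ I Rg ν A) 𝒟) ⟩
  sum (map (Λ I Rg ν A) 𝒟)             ≈⟨ ∑-vanishes 𝒟 𝒟-unique (All.tabulate (Equivalence.to (∈𝒟⇔InD _))) closed ⟩
  0#                                    ∎
  where
  open CommutativeRing Rg
  open import Relation.Binary.Reasoning.Setoid setoid
  open DefectiveCycles I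
  open Labels I Rg 1+1≈0 ν A
  open InvolutionSum Rg 1+1≈0 _≟-cover_ reverseDefectiveCycles (InD I i) (Λ I Rg ν A)
    (λ {K} ((K-cover , _) , _) → ReversalOf.reverse-involutive K K-cover)
    (λ {K} ((K-cover , #rainbow , _) , _) → Λ-reverse K K-cover #rainbow)
    (λ {K} ((K-cover , _) , K-defective) → Λ-fixed K K-cover K-defective)
  closed : ∀ {K} → K ∈ 𝒟 → reverseDefectiveCycles K ∈ 𝒟
  closed {K} K∈𝒟 with Equivalence.to (∈𝒟⇔InD K) K∈𝒟
  ... | K∈𝒟ᵢ@((K-cover , _) , _) = Equivalence.from (∈𝒟⇔InD _) (ReversalOf.InD-reverse K K-cover {i} K∈𝒟ᵢ)
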